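{- For all integers $p>0$ and $n\ge0$, \[ f_nf_{n+1}=\sum_{r=0}^{p-1}C^{(r)}_n+\sum_{j=p}^{n}\binom{j+p-1}{2p-1}f_{n-j}f_{n+1-j}. \]
   Context: $f_n=F_{n+1}$, where $F_0=0$, $F_1=1$, $F_m=F_{m-1}+F_{m-2}$ are the Fibonacci numbers. For integers $n\ge0$, $r\ge0$, $C^{(r)}_n$ is the number of tilings of a $(2n+1)$-board (a $1\times(2n+1)$ row of unit cells) by squares ($1\times1$ tiles) and $(1,1)$-fences that use exactly $2r+1$ squares; a $(1,1)$-fence is a tile consisting of two $1\times1$ posts separated by a one-cell gap, placed so that its posts occupy cells $i$ and $i+2$ while the gap cell is covered by another tile; a tiling covers each cell exactly once. (So $C^{(r)}_n=0$ if $r>n$.) An empty sum is $0$. -}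

module Defs where

open import Data.Nat using (ℕ; zero; suc; _+_; _*_; _∸_; _≡ᵇ_; _<ᵇ_)
open import Data.Bool using (Bool; true; false; _∧_; _∨_; not)
open import Data.List using (List; []; _∷_; length; map; filterᵇ; applyUpTo; upTo; concatMap)
open import Data.Bool.ListAction using (and)
open import Data.Nat.ListAction using (sum)
open import Data.Maybe using (Maybe; just; nothing)

F : ℕ → ℕ
F zero = 0
F (suc zero) = 1
F (suc (suc m)) = F (suc m) + F m

f : ℕ → ℕ
f n = F (suc n)

-- A tiling of an m-board by squares and (1,1)-fences is encoded by labelling
-- each cell: sq (covered by a square), lpost (left post of a fence, whose
-- right post is two cells to the right), rpost (right post of a fence, whose
-- left post is two cells to the left).  Each fence is determined by its
-- left post, so valid labellings are in bijection with tilings.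
data Cell : Set where
  sq lpost rpost : Cell

isSq isL isR : Cell → Bool
isSq sq = true
isSq _  = false
isL lpost = true
isL _     = false
isR rpost = true
isR _     = false

at : List Cell → ℕ → Maybe Cell
at []       _       = nothing
at (c ∷ cs) zero    = just c
at (c ∷ cs) (suc i) = at cs i

isJustR isJustL : Maybe Cell → Bool
isJustR (just c) = isR c
isJustR nothing  = false
isJustL (just c) = isL c
isJustL nothing  = false

cellOK : List Cell → ℕ → Bool
cellOK cs i with at cs i
... | just sq    = true
... | just lpost = isJustR (at cs (i + 2))
... | just rpost = (2 <ᵇ suc i) ∧ isJustL (at cs (i ∸ 2))
... | nothing    = true

validTiling : List Cell → Bool
validTiling cs = and (map (cellOK cs) (upTo (length cs)))

labellings : ℕ → List (List Cell)
labellings zero    = [] ∷ []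
labellings (suc m) = concatMap (λ cs → (sq ∷ cs) ∷ (lpost ∷ cs) ∷ (rpost ∷ cs) ∷ []) (labellings m)

numSquares : List Cell → ℕ
numSquares [] = 0
numSquares (c ∷ cs) with isSq c
... | true  = suc (numSquares cs)
... | false = numSquares cs

Ctil : ℕ → ℕ → ℕ
Ctil r n = length (filterᵇ (λ cs → validTiling cs ∧ (numSquares cs ≡ᵇ suc (2 * r)))
                        (labellings (suc (2 * n))))

-- Σ_{k=a}^{b} g k  (empty, i.e. 0, when b < a)
sumFromTo : ℕ → ℕ → (ℕ → ℕ) → ℕ
sumFromTo a b g = sum (map g (applyUpTo (a +_) (suc b ∸ a)))

{-# OPTIONS --safe #-}
-- A tiling is a sequence of blocks: a square, a fence around a square, or two interlocked
-- fences. Hence the number of tilings of an m-board with k squares obeys a linear recurrence,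
-- and with E the shift n ↦ n + 1, C⁽ʳ⁾ satisfies (E − 1)²(E + 1) C⁽ʳ⁾ = (E² + E) C⁽ʳ⁻¹⁾.
-- Let D_p(n) be the second sum of the theorem and D_0(n) = f_n f_{n+1}. Pascal's rule gives
-- (E − 1)² D_{p+1} = E D_p, so C⁽ʳ⁾ + D_{r+1} and D_r satisfy the same recurrence, with
-- forcing D_{r−1} (where C⁽⁻¹⁾ = 0 and D_{−1} = D_0), and agree on three initial values.
-- Thus C⁽ʳ⁾_n + D_{r+1}(n) = D_r(n), and the theorem follows by telescoping from D_0.
module Submission where

open import Defs
open import Data.Bool using (Bool; true; false; _∧_; _∨_; not; if_then_else_; T; T?)
open import Data.Bool.ListAction using (and)
open import Data.Bool.Properties using (∧-zeroʳ; ∧-identityʳ; ∧-comm; ∧-assoc)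
open import Data.List using (List; []; _∷_; length; map; filterᵇ; applyUpTo; concatMap)
open import Data.List.Properties using (filter-≐)
open import Data.Maybe using (just; nothing)
open import Data.Nat using (ℕ; zero; suc; pred; _+_; _*_; _∸_; _≤_; _<_; _≤?_; _<ᵇ_; _≡ᵇ_; z≤n; s≤s)
open import Data.Nat.Properties
  using (+-assoc; +-suc; +-identityʳ; *-assoc; *-distribʳ-+; +-cancelʳ-≡; +-comm;
         ≤-trans; <-≤-trans; ≤-<-trans; n≤1+n; m<n⇒m<1+n; ≤-pred; ≰⇒>;
         m≤n⇒m∸n≡0; m≤n⇒∃[o]m+o≡n; [m+n]∸[m+o]≡n∸o; +-∸-assoc; *-monoʳ-<;
         +-monoˡ-≤; ≤-reflexive; m+n∸m≡n)
open import Data.Nat.Combinatorics using (_C_; nCk+nC[k+1]≡[n+1]C[k+1]; k>n⇒nCk≡0)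
open import Data.Nat.ListAction using (sum)
open import Data.Nat.Tactic.RingSolver using (solve-∀)
open import Data.Product using (_×_; _,_; proj₁)
open import Function using (_∘_; id)
open import Relation.Nullary using (yes; no)
open import Relation.Binary.PropositionalEquality
  using (_≡_; refl; sym; trans; cong; cong₂; subst; module ≡-Reasoning)
open ≡-Reasoning

map-applyUpTo : ∀ {A B : Set} (g : A → B) (h : ℕ → A) n →
                map g (applyUpTo h n) ≡ applyUpTo (g ∘ h) n
map-applyUpTo g h zero    = refl
map-applyUpTo g h (suc n) = cong (g (h 0) ∷_) (map-applyUpTo g (h ∘ suc) n)

applyUpTo-cong : ∀ {A : Set} {g h : ℕ → A} → (∀ i → g i ≡ h i) → ∀ n →
                 applyUpTo g n ≡ applyUpTo h n
applyUpTo-cong g≗h zero    = refl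
applyUpTo-cong g≗h (suc n) = cong₂ _∷_ (g≗h 0) (applyUpTo-cong (g≗h ∘ suc) n)

length-filterᵇ-∷ : ∀ {A : Set} (P : A → Bool) x xs →
  length (filterᵇ P (x ∷ xs)) ≡ (if P x then 1 else 0) + length (filterᵇ P xs)
length-filterᵇ-∷ P x xs with P x
... | true  = refl
... | false = refl

length-filterᵇ-false : ∀ {A : Set} (xs : List A) → length (filterᵇ (λ _ → false) xs) ≡ 0
length-filterᵇ-false []       = refl
length-filterᵇ-false (x ∷ xs) = length-filterᵇ-false xs

length-filterᵇ-concatMap₃ : ∀ {A B : Set} (P : B → Bool) (a b c : A → B) xs →
  length (filterᵇ P (concatMap (λ x → a x ∷ b x ∷ c x ∷ []) xs))
  ≡ length (filterᵇ (P ∘ a) xs) + length (filterᵇ (P ∘ b) xs) + length (filterᵇ (P ∘ c) xs)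
length-filterᵇ-concatMap₃ P a b c []       = refl
length-filterᵇ-concatMap₃ {B = B} P a b c (x ∷ xs) = begin
  length (filterᵇ P (a x ∷ b x ∷ c x ∷ rest))
    ≡⟨ length-filterᵇ-∷ P (a x) _ ⟩
  ι (a x) + length (filterᵇ P (b x ∷ c x ∷ rest))
    ≡⟨ cong (ι (a x) +_) (length-filterᵇ-∷ P (b x) _) ⟩
  ι (a x) + (ι (b x) + length (filterᵇ P (c x ∷ rest)))
    ≡⟨ cong (λ l → ι (a x) + (ι (b x) + l)) (length-filterᵇ-∷ P (c x) _) ⟩
  ι (a x) + (ι (b x) + (ι (c x) + length (filterᵇ P rest)))
    ≡⟨ cong (λ l → ι (a x) + (ι (b x) + (ι (c x) + l))) (length-filterᵇ-concatMap₃ P a b c xs) ⟩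
  ι (a x) + (ι (b x) + (ι (c x) + (#a + #b + #c)))
    ≡⟨ interchange (ι (a x)) (ι (b x)) (ι (c x)) #a #b #c ⟩
  (ι (a x) + #a) + (ι (b x) + #b) + (ι (c x) + #c)
    ≡⟨ sym (cong₂ _+_ (cong₂ _+_ (length-filterᵇ-∷ (P ∘ a) x xs) (length-filterᵇ-∷ (P ∘ b) x xs))
                              (length-filterᵇ-∷ (P ∘ c) x xs)) ⟩
  length (filterᵇ (P ∘ a) (x ∷ xs)) + length (filterᵇ (P ∘ b) (x ∷ xs))
    + length (filterᵇ (P ∘ c) (x ∷ xs)) ∎
  where
  rest : List B
  rest = concatMap (λ x → a x ∷ b x ∷ c x ∷ []) xs
  ι : B → ℕ
  ι y = if P y then 1 else 0
  #a #b #c : ℕ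
  #a = length (filterᵇ (P ∘ a) xs)
  #b = length (filterᵇ (P ∘ b) xs)
  #c = length (filterᵇ (P ∘ c) xs)
  interchange : ∀ u v w x y z → u + (v + (w + (x + y + z))) ≡ (u + x) + (v + y) + (w + z)
  interchange = solve-∀

sumBelow : ℕ → (ℕ → ℕ) → ℕ
sumBelow zero    h = 0
sumBelow (suc L) h = h 0 + sumBelow L (h ∘ suc)

sum-map-applyUpTo : ∀ (h u : ℕ → ℕ) L → sum (map h (applyUpTo u L)) ≡ sumBelow L (h ∘ u)
sum-map-applyUpTo h u zero    = refl
sum-map-applyUpTo h u (suc L) = cong (h (u 0) +_) (sum-map-applyUpTo h (u ∘ suc) L)

sumBelow-cong : ∀ L {g h : ℕ → ℕ} → (∀ i → i < L → g i ≡ h i) → sumBelow L g ≡ sumBelow L h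
sumBelow-cong zero    g≗h = refl
sumBelow-cong (suc L) g≗h = cong₂ _+_ (g≗h 0 (s≤s z≤n)) (sumBelow-cong L (λ i i<L → g≗h (suc i) (s≤s i<L)))

sumBelow-zero : ∀ L h → (∀ i → i < L → h i ≡ 0) → sumBelow L h ≡ 0
sumBelow-zero zero    h h≡0 = refl
sumBelow-zero (suc L) h h≡0 =
  cong₂ _+_ (h≡0 0 (s≤s z≤n)) (sumBelow-zero L (h ∘ suc) (λ i i<L → h≡0 (suc i) (s≤s i<L)))

sumBelow-+ : ∀ L g h → sumBelow L (λ i → g i + h i) ≡ sumBelow L g + sumBelow L h
sumBelow-+ zero    g h = refl
sumBelow-+ (suc L) g h = trans (cong (g 0 + h 0 +_) (sumBelow-+ L (g ∘ suc) (h ∘ suc)))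
                               (interchange (g 0) (h 0) _ _)
  where
  interchange : ∀ x y s t → (x + y) + (s + t) ≡ (x + s) + (y + t)
  interchange = solve-∀

sumBelow-++ : ∀ K L h → sumBelow (K + L) h ≡ sumBelow K h + sumBelow L (λ i → h (K + i))
sumBelow-++ zero    L h = refl
sumBelow-++ (suc K) L h = trans (cong (h 0 +_) (sumBelow-++ K L (h ∘ suc))) (sym (+-assoc (h 0) _ _))

sumBelow-suc : ∀ L h → sumBelow (suc L) h ≡ sumBelow L h + h L
sumBelow-suc zero    h = +-comm (h 0) 0
sumBelow-suc (suc L) h = trans (cong (h 0 +_) (sumBelow-suc L (h ∘ suc))) (sym (+-assoc (h 0) _ _))

-- Validity of a labelling as a finite automaton

_⇔ᵇ_ : Bool → Bool → Bool
true  ⇔ᵇ b = b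
false ⇔ᵇ b = not b

-- The two flags say whether the current and the next cell must be right posts of
-- fences opened earlier.
accepts : Bool → Bool → List Cell → Bool
accepts now next []       = not now ∧ not next
accepts now next (c ∷ cs) = (isR c ⇔ᵇ now) ∧ accepts next (isL c) cs

-- cellOK for cs preceded by two virtual cells whose left-post flags are l₂ and l₁.
leftPostTwoBefore : Bool → Bool → List Cell → ℕ → Bool
leftPostTwoBefore l₂ l₁ cs zero          = l₂
leftPostTwoBefore l₂ l₁ cs (suc zero)    = l₁
leftPostTwoBefore l₂ l₁ cs (suc (suc i)) = isJustL (at cs i)

cellOKAfter : Bool → Bool → List Cell → ℕ → Bool
cellOKAfter l₂ l₁ cs i with at cs i
... | just sq    = true
... | just lpost = isJustR (at cs (i + 2))
... | just rpost = leftPostTwoBefore l₂ l₁ cs i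
... | nothing    = true

allCellsOKAfter : Bool → Bool → List Cell → Bool
allCellsOKAfter l₂ l₁ cs = and (applyUpTo (cellOKAfter l₂ l₁ cs) (length cs))

virtualFencesClosed : Bool → Bool → List Cell → Bool
virtualFencesClosed l₂ l₁ cs = (not l₂ ∨ isJustR (at cs 0)) ∧ (not l₁ ∨ isJustR (at cs 1))

cellOK≡cellOKAfter : ∀ cs i → cellOK cs i ≡ cellOKAfter false false cs i
cellOK≡cellOKAfter cs i with at cs i
... | just sq    = refl
... | just lpost = refl
... | just rpost = rightPostOK i
  where
  rightPostOK : ∀ i → ((2 <ᵇ suc i) ∧ isJustL (at cs (i ∸ 2))) ≡ leftPostTwoBefore false false cs i
  rightPostOK zero          = refl
  rightPostOK (suc zero)    = refl
  rightPostOK (suc (suc i)) = refl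
... | nothing    = refl

cellOKAfter-∷ : ∀ l₂ l₁ c cs i → cellOKAfter l₂ l₁ (c ∷ cs) (suc i) ≡ cellOKAfter l₁ (isL c) cs i
cellOKAfter-∷ l₂ l₁ c cs i with at cs i
... | just sq    = refl
... | just lpost = refl
... | just rpost = leftPostTwoBefore-∷ i
  where
  leftPostTwoBefore-∷ : ∀ i → leftPostTwoBefore l₂ l₁ (c ∷ cs) (suc i) ≡ leftPostTwoBefore l₁ (isL c) cs i
  leftPostTwoBefore-∷ zero          = refl
  leftPostTwoBefore-∷ (suc zero)    = refl
  leftPostTwoBefore-∷ (suc (suc i)) = refl
... | nothing    = refl

allCellsOKAfter-∷ : ∀ l₂ l₁ c cs →
  allCellsOKAfter l₂ l₁ (c ∷ cs) ≡ cellOKAfter l₂ l₁ (c ∷ cs) 0 ∧ allCellsOKAfter l₁ (isL c) cs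
allCellsOKAfter-∷ l₂ l₁ c cs =
  cong (λ bs → cellOKAfter l₂ l₁ (c ∷ cs) 0 ∧ and bs) (applyUpTo-cong (cellOKAfter-∷ l₂ l₁ c cs) (length cs))

-- The head condition "right post iff l₂" splits into the cellOK check of a right post
-- and the closing of the virtual fence two cells back.
accepts-head : ∀ l₂ l₁ c cs X →
  (isR c ⇔ᵇ l₂) ∧ (X ∧ virtualFencesClosed l₁ (isL c) cs)
  ≡ (cellOKAfter l₂ l₁ (c ∷ cs) 0 ∧ X) ∧ virtualFencesClosed l₂ l₁ (c ∷ cs)
accepts-head false false sq    cs X = refl
accepts-head false true  sq    cs X = cong (X ∧_) (∧-identityʳ _)
accepts-head true  l₁    sq    cs X = sym (∧-zeroʳ X)
accepts-head false l₁    lpost cs X = begin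
  X ∧ (r₀ ∧ r₁)   ≡⟨ cong (X ∧_) (∧-comm r₀ r₁) ⟩
  X ∧ (r₁ ∧ r₀)   ≡⟨ sym (∧-assoc X r₁ r₀) ⟩
  (X ∧ r₁) ∧ r₀   ≡⟨ cong (_∧ r₀) (∧-comm X r₁) ⟩
  (r₁ ∧ X) ∧ r₀   ∎
  where
  r₀ r₁ : Bool
  r₀ = not l₁ ∨ isJustR (at cs 0)
  r₁ = isJustR (at cs 1)
accepts-head true  l₁    lpost cs X = sym (∧-zeroʳ _)
accepts-head false l₁    rpost cs X = refl
accepts-head true  false rpost cs X = refl
accepts-head true  true  rpost cs X = cong (X ∧_) (∧-identityʳ _)

accepts≡allCellsOKAfter∧virtualFencesClosed : ∀ l₂ l₁ cs →
  accepts l₂ l₁ cs ≡ allCellsOKAfter l₂ l₁ cs ∧ virtualFencesClosed l₂ l₁ cs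
accepts≡allCellsOKAfter∧virtualFencesClosed false false [] = refl
accepts≡allCellsOKAfter∧virtualFencesClosed false true  [] = refl
accepts≡allCellsOKAfter∧virtualFencesClosed true  l₁    [] = refl
accepts≡allCellsOKAfter∧virtualFencesClosed l₂ l₁ (c ∷ cs) = begin
  (isR c ⇔ᵇ l₂) ∧ accepts l₁ (isL c) cs
    ≡⟨ cong ((isR c ⇔ᵇ l₂) ∧_) (accepts≡allCellsOKAfter∧virtualFencesClosed l₁ (isL c) cs) ⟩
  (isR c ⇔ᵇ l₂) ∧ (allCellsOKAfter l₁ (isL c) cs ∧ virtualFencesClosed l₁ (isL c) cs)
    ≡⟨ accepts-head l₂ l₁ c cs _ ⟩
  (cellOKAfter l₂ l₁ (c ∷ cs) 0 ∧ allCellsOKAfter l₁ (isL c) cs) ∧ virtualFencesClosed l₂ l₁ (c ∷ cs)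
    ≡⟨ cong (_∧ virtualFencesClosed l₂ l₁ (c ∷ cs)) (sym (allCellsOKAfter-∷ l₂ l₁ c cs)) ⟩
  allCellsOKAfter l₂ l₁ (c ∷ cs) ∧ virtualFencesClosed l₂ l₁ (c ∷ cs) ∎

validTiling≡accepts : ∀ cs → validTiling cs ≡ accepts false false cs
validTiling≡accepts cs = begin
  and (map (cellOK cs) (applyUpTo id (length cs)))
    ≡⟨ cong and (map-applyUpTo (cellOK cs) id (length cs)) ⟩
  and (applyUpTo (cellOK cs) (length cs))
    ≡⟨ cong and (applyUpTo-cong (cellOK≡cellOKAfter cs) (length cs)) ⟩
  allCellsOKAfter false false cs
    ≡⟨ sym (∧-identityʳ _) ⟩
  allCellsOKAfter false false cs ∧ virtualFencesClosed false false cs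
    ≡⟨ sym (accepts≡allCellsOKAfter∧virtualFencesClosed false false cs) ⟩
  accepts false false cs ∎

count : ℕ → (List Cell → Bool) → ℕ
count m P = length (filterᵇ P (labellings m))

count-cong : ∀ m {P Q : List Cell → Bool} → (∀ cs → P cs ≡ Q cs) → count m P ≡ count m Q
count-cong m {P} {Q} P≗Q =
  cong length (filter-≐ (T? ∘ P) (T? ∘ Q)
    ((λ {cs} → subst T (P≗Q cs)) , (λ {cs} → subst T (sym (P≗Q cs)))) (labellings m))

count-suc : ∀ m P → count (suc m) P
  ≡ count m (P ∘ (sq ∷_)) + count m (P ∘ (lpost ∷_)) + count m (P ∘ (rpost ∷_))
count-suc m P = length-filterᵇ-concatMap₃ P (sq ∷_) (lpost ∷_) (rpost ∷_) (labellings m)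

shift : (ℕ → ℕ) → ℕ → ℕ
shift h zero    = 0
shift h (suc k) = h k

accepted : Bool → Bool → ℕ → ℕ → ℕ
accepted true  next  (suc m) k       = accepted next false m k
accepted false next  (suc m) k       = shift (accepted next false m) k + accepted next true m k
accepted false false zero    zero    = 1
accepted false false zero    (suc k) = 0
accepted false true  zero    k       = 0
accepted true  next  zero    k       = 0

count-accepts : ∀ m now next k →
  count m (λ cs → accepts now next cs ∧ (numSquares cs ≡ᵇ k)) ≡ accepted now next m k
count-accepts zero    false false zero    = refl
count-accepts zero    false false (suc k) = refl
count-accepts zero    false true  k       = refl
count-accepts zero    true  next  k       = refl
count-accepts (suc m) true  next  k       =
  trans (count-suc m _)
        (cong₂ _+_ (cong₂ _+_ (length-filterᵇ-false (labellings m)) (length-filterᵇ-false (labellings m)))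
                   (count-accepts m next false k))
count-accepts (suc m) false next  zero    =
  trans (count-suc m _)
        (trans (cong₂ _+_ (cong₂ _+_ noSquare (count-accepts m next true zero))
                          (length-filterᵇ-false (labellings m)))
               (+-identityʳ _))
  where
  noSquare : count m (λ cs → accepts next false cs ∧ false) ≡ 0
  noSquare = trans (count-cong m (λ cs → ∧-zeroʳ _)) (length-filterᵇ-false (labellings m))
count-accepts (suc m) false next  (suc k) =
  trans (count-suc m _)
        (trans (cong₂ _+_ (cong₂ _+_ (count-accepts m next false k) (count-accepts m next true (suc k)))
                          (length-filterᵇ-false (labellings m)))
               (+-identityʳ _))

accepted-vanishes : ∀ now next m k → m < k → accepted now next m k ≡ 0
accepted-vanishes false false zero    (suc k) _         = refl
accepted-vanishes false true  zero    k       _         = refl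
accepted-vanishes true  next  zero    k       _         = refl
accepted-vanishes true  next  (suc m) k       m<k       =
  accepted-vanishes next false m k (≤-trans (n≤1+n _) m<k)
accepted-vanishes false next  (suc m) (suc k) (s≤s m<k) =
  cong₂ _+_ (accepted-vanishes next false m k m<k) (accepted-vanishes next true m (suc k) (m<n⇒m<1+n m<k))

tilings : ℕ → ℕ → ℕ
tilings = accepted false false

-- A tiling starts with a square, a fence around a square, or two interlocked fences.
tilings-blocks : ∀ m k → tilings (4 + m) k ≡ shift (tilings (3 + m)) k + shift (tilings (1 + m)) k + tilings m k
tilings-blocks m k = sym (+-assoc (shift (tilings (3 + m)) k) _ _)

shift-tilings-blocks : ∀ m k →
  shift (tilings (4 + m)) k
  ≡ shift (shift (tilings (3 + m))) k + shift (shift (tilings (1 + m))) k + shift (tilings m) k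
shift-tilings-blocks m zero    = refl
shift-tilings-blocks m (suc k) = tilings-blocks m k

tilings-sixStep : ∀ m k → tilings (6 + m) k + tilings m k
  ≡ shift (shift (tilings (4 + m))) k + shift (shift (tilings (2 + m))) k + tilings (4 + m) k + tilings (2 + m) k
tilings-sixStep m k =
  eliminate _ _ _ _ (shift (shift (tilings (4 + m))) k) (shift (shift (tilings (2 + m))) k) _ _ _
            (tilings-blocks (2 + m) k) (shift-tilings-blocks (1 + m) k) (tilings-blocks m k)
  where
  eliminate : ∀ t₆ s₅ s₃ t₂ ss₄ ss₂ s₁ t₄ t₀ →
    t₆ ≡ s₅ + s₃ + t₂ → s₅ ≡ ss₄ + ss₂ + s₁ → t₄ ≡ s₃ + s₁ + t₀ → t₆ + t₀ ≡ ss₄ + ss₂ + t₄ + t₂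
  eliminate _ _ s₃ t₂ ss₄ ss₂ s₁ _ t₀ refl refl refl = arith s₃ t₂ ss₄ ss₂ s₁ t₀
    where
    arith : ∀ s₃ t₂ ss₄ ss₂ s₁ t₀ →
      ss₄ + ss₂ + s₁ + s₃ + t₂ + t₀ ≡ ss₄ + ss₂ + (s₃ + s₁ + t₀) + t₂
    arith = solve-∀

oddTilings : ℕ → ℕ → ℕ
oddTilings r n = tilings (suc (2 * n)) (suc (2 * r))

Ctil≡oddTilings : ∀ r n → Ctil r n ≡ oddTilings r n
Ctil≡oddTilings r n =
  trans (count-cong (suc (2 * n)) (λ cs → cong (_∧ (numSquares cs ≡ᵇ suc (2 * r))) (validTiling≡accepts cs)))
        (count-accepts (suc (2 * n)) false false (suc (2 * r)))

previousOdd : ℕ → ℕ → ℕ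
previousOdd r n = shift (λ s → oddTilings s n) r

oddTilings-vanishes : ∀ r n → n < r → oddTilings r n ≡ 0
oddTilings-vanishes r n n<r = accepted-vanishes false false _ _ (s≤s (*-monoʳ-< 2 n<r))

-- A third-order linear recurrence

-- (E − 1)²(E + 1) X = (E² + E) U, where E is the shift n ↦ n + 1.
record Recurs (X U : ℕ → ℕ) : Set where
  field step : ∀ n → X (3 + n) + X n ≡ X (2 + n) + X (1 + n) + (U (2 + n) + U (1 + n))
open Recurs

Recurs-+ : ∀ {X Y U V} → Recurs X U → Recurs Y V → Recurs (λ n → X n + Y n) (λ n → U n + V n)
Recurs-+ {X} {Y} {U} {V} rX rY .step n =
  trans (interchange (X (3 + n)) (Y (3 + n)) (X n) (Y n))
  (trans (cong₂ _+_ (step rX n) (step rY n))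
         (regroup (X (2 + n)) (X (1 + n)) (U (2 + n)) (U (1 + n))
                  (Y (2 + n)) (Y (1 + n)) (V (2 + n)) (V (1 + n))))
  where
  interchange : ∀ a b c d → (a + b) + (c + d) ≡ (a + c) + (b + d)
  interchange = solve-∀
  regroup : ∀ x₂ x₁ u₂ u₁ y₂ y₁ v₂ v₁ → (x₂ + x₁ + (u₂ + u₁)) + (y₂ + y₁ + (v₂ + v₁))
                                       ≡ (x₂ + y₂) + (x₁ + y₁) + ((u₂ + v₂) + (u₁ + v₁))
  regroup = solve-∀

Recurs-cong : ∀ {X U V} → (∀ n → U n ≡ V n) → Recurs X U → Recurs X V
Recurs-cong {X} U≗V rX .step n =
  trans (step rX n) (cong (X (2 + n) + X (1 + n) +_) (cong₂ _+_ (U≗V (2 + n)) (U≗V (1 + n))))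

Recurs-unique : ∀ {X Y U} → Recurs X U → Recurs Y U →
                X 0 ≡ Y 0 → X 1 ≡ Y 1 → X 2 ≡ Y 2 → ∀ n → X n ≡ Y n
Recurs-unique {X} {Y} {U} rX rY e₀ e₁ e₂ n = proj₁ (window n)
  where
  window : ∀ n → X n ≡ Y n × X (1 + n) ≡ Y (1 + n) × X (2 + n) ≡ Y (2 + n)
  window zero    = e₀ , e₁ , e₂
  window (suc n) with window n
  ... | eₙ , eₙ₊₁ , eₙ₊₂ = eₙ₊₁ , eₙ₊₂ , +-cancelʳ-≡ (X n) _ _ (begin
    X (3 + n) + X n                           ≡⟨ step rX n ⟩
    X (2 + n) + X (1 + n) + forcing           ≡⟨ cong (_+ forcing) (cong₂ _+_ eₙ₊₂ eₙ₊₁) ⟩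
    Y (2 + n) + Y (1 + n) + forcing           ≡⟨ sym (step rY n) ⟩
    Y (3 + n) + Y n                           ≡⟨ cong (Y (3 + n) +_) (sym eₙ) ⟩
    Y (3 + n) + X n                           ∎)
    where
    forcing : ℕ
    forcing = U (2 + n) + U (1 + n)

shift-double : ∀ h r → shift h (2 * r) ≡ shift (λ s → h (suc (2 * s))) r
shift-double h zero    = refl
shift-double h (suc r) = cong h (+-suc r (r + 0))

oddTilings-Recurs : ∀ r → Recurs (oddTilings r) (previousOdd r)
oddTilings-Recurs r .step n = begin
  tilings (suc (2 * (3 + n))) k + tilings m k
    ≡⟨ cong (λ b → b k + tilings m k) (sym (row 3)) ⟩
  tilings (6 + m) k + tilings m k
    ≡⟨ tilings-sixStep m k ⟩
  shift (tilings (4 + m)) (2 * r) + shift (tilings (2 + m)) (2 * r) + tilings (4 + m) k + tilings (2 + m) k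
    ≡⟨ cong₂ _+_ (cong₂ _+_ (cong₂ _+_ (previous 2) (previous 1)) (cong (λ b → b k) (row 2)))
                 (cong (λ b → b k) (row 1)) ⟩
  previousOdd r (2 + n) + previousOdd r (1 + n) + oddTilings r (2 + n) + oddTilings r (1 + n)
    ≡⟨ regroup (previousOdd r (2 + n)) (previousOdd r (1 + n)) (oddTilings r (2 + n)) (oddTilings r (1 + n)) ⟩
  oddTilings r (2 + n) + oddTilings r (1 + n) + (previousOdd r (2 + n) + previousOdd r (1 + n)) ∎
  where
  m k : ℕ
  m = suc (2 * n)
  k = suc (2 * r)
  row : ∀ j → tilings (2 * j + m) ≡ tilings (suc (2 * (j + n)))
  row j = cong tilings (arith j n)
    where
    arith : ∀ j n → 2 * j + suc (2 * n) ≡ suc (2 * (j + n))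
    arith = solve-∀
  previous : ∀ j → shift (tilings (2 * j + m)) (2 * r) ≡ previousOdd r (j + n)
  previous j = trans (cong (λ b → shift b (2 * r)) (row j)) (shift-double _ r)
  regroup : ∀ a b c d → a + b + c + d ≡ c + d + (a + b)
  regroup = solve-∀

fibProduct : ℕ → ℕ
fibProduct n = f n * f (suc n)

fibProduct-Recurs : Recurs fibProduct fibProduct
fibProduct-Recurs .step n = identity (F (suc n)) (F (suc (suc n)))
  where
  identity : ∀ x y →
    ((y + x) + y) * (((y + x) + y) + (y + x)) + x * y
    ≡ (y + x) * ((y + x) + y) + y * (y + x) + ((y + x) * ((y + x) + y) + y * (y + x))
  identity = solve-∀

binomConv : (ℕ → ℕ) → ℕ → ℕ → ℕ
binomConv u q N = sumBelow (suc N) (λ j → (j C q) * u (N ∸ j))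

binomConv-pascal : ∀ u q N → binomConv u (suc q) (suc N) ≡ binomConv u (suc q) N + binomConv u q N
binomConv-pascal u q N = begin
  sumBelow (suc N) (λ j → (suc j C suc q) * u (N ∸ j))
    ≡⟨ sumBelow-cong (suc N) (λ j _ → trans (cong (_* u (N ∸ j)) (sym (nCk+nC[k+1]≡[n+1]C[k+1] j q)))
                                            (*-distribʳ-+ (u (N ∸ j)) (j C q) (j C suc q))) ⟩
  sumBelow (suc N) (λ j → (j C q) * u (N ∸ j) + (j C suc q) * u (N ∸ j))
    ≡⟨ sumBelow-+ (suc N) (λ j → (j C q) * u (N ∸ j)) (λ j → (j C suc q) * u (N ∸ j)) ⟩
  binomConv u q N + binomConv u (suc q) N
    ≡⟨ +-comm (binomConv u q N) _ ⟩
  binomConv u (suc q) N + binomConv u q N ∎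

binomConv-zero-suc : ∀ u N → binomConv u 0 (suc N) ≡ binomConv u 0 N + u (suc N)
binomConv-zero-suc u N = trans (cong (_+ binomConv u 0 N) (+-identityʳ (u (suc N)))) (+-comm (u (suc N)) _)

binomConv-vanishes : ∀ u q N → N < q → binomConv u q N ≡ 0
binomConv-vanishes u q N N<q =
  sumBelow-zero (suc N) _ (λ j j≤N → cong (_* u (N ∸ j)) (k>n⇒nCk≡0 (≤-<-trans (≤-pred j≤N) N<q)))

binomConv-from : ∀ u q d → binomConv u q (q + d) ≡ sumBelow (suc d) (λ i → ((q + i) C q) * u (d ∸ i))
binomConv-from u q d = begin
  sumBelow (suc (q + d)) term
    ≡⟨ cong (λ L → sumBelow L term) (sym (+-suc q d)) ⟩
  sumBelow (q + suc d) term
    ≡⟨ sumBelow-++ q (suc d) term ⟩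
  sumBelow q term + sumBelow (suc d) (λ i → term (q + i))
    ≡⟨ cong₂ _+_ (sumBelow-zero q term (λ j j<q → cong (_* u (q + d ∸ j)) (k>n⇒nCk≡0 j<q)))
                 (sumBelow-cong (suc d) (λ i _ → cong (λ x → ((q + i) C q) * u x) ([m+n]∸[m+o]≡n∸o q d i))) ⟩
  sumBelow (suc d) (λ i → ((q + i) C q) * u (d ∸ i)) ∎
  where
  term : ℕ → ℕ
  term j = (j C q) * u (q + d ∸ j)

-- For p > 0, tailSum p n is the second sum of the theorem, reindexed by j ↦ j + p − 1.
tailSum : ℕ → ℕ → ℕ
tailSum zero    n = fibProduct n
tailSum (suc r) n = binomConv fibProduct (suc (2 * r)) (n + r)

tailSum-vanishes : ∀ r n → n < r → tailSum r n ≡ 0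
tailSum-vanishes (suc r) n (s≤s n≤r) =
  binomConv-vanishes fibProduct _ _
    (s≤s (≤-trans (+-monoˡ-≤ r n≤r) (≤-reflexive (cong (r +_) (sym (+-identityʳ r))))))

second-difference : ∀ {x₂ x₁ x₀ y₁ y₀ z} → x₂ ≡ x₁ + y₁ → y₁ ≡ y₀ + z → x₁ ≡ x₀ + y₀ → x₂ + x₀ ≡ x₁ + x₁ + z
second-difference {x₁ = x₁} {x₀} {y₀ = y₀} {z} refl refl refl = arith x₀ y₀ z
  where
  arith : ∀ x₀ y₀ z → x₀ + y₀ + (y₀ + z) + x₀ ≡ x₀ + y₀ + (x₀ + y₀) + z
  arith = solve-∀

tailSum-Δ² : ∀ r n → tailSum (suc r) (2 + n) + tailSum (suc r) n
                   ≡ tailSum (suc r) (1 + n) + tailSum (suc r) (1 + n) + tailSum r (1 + n)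
tailSum-Δ² zero n =
  trans (second-difference (binomConv-pascal fibProduct 0 (suc (n + 0))) (binomConv-zero-suc fibProduct (n + 0))
                           (binomConv-pascal fibProduct 0 (n + 0)))
        (cong (λ m → tailSum 1 (1 + n) + tailSum 1 (1 + n) + fibProduct (suc m)) (+-identityʳ n))
tailSum-Δ² (suc r) n = begin
  tailSum (2 + r) (2 + n) + tailSum (2 + r) n
    ≡⟨ cong₂ _+_ (unfold (2 + n)) (unfold n) ⟩
  B (3 + (n + r)) + B (1 + (n + r))
    ≡⟨ second-difference (binomConv-pascal fibProduct (suc q) (2 + (n + r)))
                         (binomConv-pascal fibProduct q (1 + (n + r)))
                         (binomConv-pascal fibProduct (suc q) (1 + (n + r))) ⟩
  B (2 + (n + r)) + B (2 + (n + r)) + tailSum (suc r) (1 + n)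
    ≡⟨ cong (λ t → t + t + tailSum (suc r) (1 + n)) (sym (unfold (1 + n))) ⟩
  tailSum (2 + r) (1 + n) + tailSum (2 + r) (1 + n) + tailSum (suc r) (1 + n) ∎
  where
  q : ℕ
  q = suc (2 * r)
  B : ℕ → ℕ
  B = binomConv fibProduct (2 + q)
  unfold : ∀ n → tailSum (2 + r) n ≡ B (suc (n + r))
  unfold n = cong₂ (binomConv fibProduct) (cong (2 +_) (+-suc r (r + 0))) (+-suc n r)

tailSum-Recurs : ∀ r → Recurs (tailSum r) (tailSum (pred r))
tailSum-Recurs zero    = fibProduct-Recurs
tailSum-Recurs (suc r) .step n =
  add-consecutive {D (3 + n)} {D (2 + n)} {D (1 + n)} {D n} (tailSum-Δ² r (1 + n)) (tailSum-Δ² r n)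
  where
  D : ℕ → ℕ
  D = tailSum (suc r)
  add-consecutive : ∀ {a₃ a₂ a₁ a₀ e₂ e₁} → a₃ + a₁ ≡ a₂ + a₂ + e₂ → a₂ + a₀ ≡ a₁ + a₁ + e₁ →
                    a₃ + a₀ ≡ a₂ + a₁ + (e₂ + e₁)
  add-consecutive {a₃} {a₂} {a₁} {a₀} {e₂} {e₁} h₃ h₂ = +-cancelʳ-≡ (a₁ + a₂) _ _ (begin
    (a₃ + a₀) + (a₁ + a₂)                     ≡⟨ interchange a₃ a₀ a₁ a₂ ⟩
    (a₃ + a₁) + (a₂ + a₀)                     ≡⟨ cong₂ _+_ h₃ h₂ ⟩
    (a₂ + a₂ + e₂) + (a₁ + a₁ + e₁)           ≡⟨ regroup a₂ a₁ e₂ e₁ ⟩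
    (a₂ + a₁ + (e₂ + e₁)) + (a₁ + a₂)         ∎)
    where
    interchange : ∀ a b c d → (a + b) + (c + d) ≡ (a + c) + (d + b)
    interchange = solve-∀
    regroup : ∀ a b c d → (a + a + c) + (b + b + d) ≡ (a + b + (c + d)) + (b + a)
    regroup = solve-∀

initial-values : ∀ r j → j < 3 → oddTilings r j + tailSum (suc r) j ≡ tailSum r j
initial-values 0 0 _ = refl
initial-values 0 1 _ = refl
initial-values 0 2 _ = refl
initial-values 1 0 _ = refl
initial-values 1 1 _ = refl
initial-values 1 2 _ = refl
initial-values 2 0 _ = refl
initial-values 2 1 _ = refl
initial-values 2 2 _ = refl
initial-values r@(suc (suc (suc _))) j j<3 =
  trans (cong₂ _+_ (oddTilings-vanishes r j j<r) (tailSum-vanishes (suc r) j (m<n⇒m<1+n j<r)))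
        (sym (tailSum-vanishes r j j<r))
  where
  j<r : j < r
  j<r = <-≤-trans j<3 (s≤s (s≤s (s≤s z≤n)))
initial-values r (suc (suc (suc j))) (s≤s (s≤s (s≤s ())))

mutual
  oddTilings+tailSum : ∀ r n → oddTilings r n + tailSum (suc r) n ≡ tailSum r n
  oddTilings+tailSum r =
    Recurs-unique
      (Recurs-cong (previousOdd+tailSum r)
                   (Recurs-+ (oddTilings-Recurs r) (tailSum-Recurs (suc r))))
      (tailSum-Recurs r)
      (initial-values r 0 (s≤s z≤n)) (initial-values r 1 (s≤s (s≤s z≤n)))
      (initial-values r 2 (s≤s (s≤s (s≤s z≤n))))

  previousOdd+tailSum : ∀ r n → previousOdd r n + tailSum r n ≡ tailSum (pred r) n
  previousOdd+tailSum zero    n = refl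
  previousOdd+tailSum (suc r) n = oddTilings+tailSum r n

fibProduct-telescope : ∀ p n → fibProduct n ≡ sumBelow p (λ r → oddTilings r n) + tailSum p n
fibProduct-telescope zero    n = refl
fibProduct-telescope (suc p) n = begin
  fibProduct n                                        ≡⟨ fibProduct-telescope p n ⟩
  sumBelow p C + tailSum p n                          ≡⟨ cong (sumBelow p C +_) (sym (oddTilings+tailSum p n)) ⟩
  sumBelow p C + (oddTilings p n + tailSum (suc p) n) ≡⟨ sym (+-assoc (sumBelow p C) (oddTilings p n) _) ⟩
  sumBelow p C + oddTilings p n + tailSum (suc p) n   ≡⟨ cong (_+ tailSum (suc p) n) (sym (sumBelow-suc p C)) ⟩
  sumBelow (suc p) C + tailSum (suc p) n              ∎
  where
  C : ℕ → ℕ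
  C r = oddTilings r n

tailTerm : ℕ → ℕ → ℕ → ℕ
tailTerm p n j = ((j + p ∸ 1) C (2 * p ∸ 1)) * f (n ∸ j) * f (suc n ∸ j)

tailTerm-shifted : ∀ p d i → i ≤ d →
  tailTerm (suc p) (suc p + d) (suc p + i) ≡ ((suc (2 * p) + i) C suc (2 * p)) * fibProduct (d ∸ i)
tailTerm-shifted p d i i≤d =
  trans (cong₂ _*_ (cong₂ _*_ (cong₂ _C_ top bottom) (cong f ([m+n]∸[m+o]≡n∸o (suc p) d i))) (cong f next))
        (*-assoc ((suc (2 * p) + i) C suc (2 * p)) (f (d ∸ i)) (f (suc (d ∸ i))))
  where
  top : suc p + i + suc p ∸ 1 ≡ suc (2 * p) + i
  top = arith p i
    where
    arith : ∀ p i → p + i + suc p ≡ suc (2 * p) + i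
    arith = solve-∀
  bottom : 2 * suc p ∸ 1 ≡ suc (2 * p)
  bottom = +-suc p (p + 0)
  next : suc (suc p + d) ∸ (suc p + i) ≡ suc (d ∸ i)
  next = begin
    suc (suc p + d) ∸ (suc p + i)   ≡⟨ cong (_∸ (suc p + i)) (sym (+-suc (suc p) d)) ⟩
    suc p + suc d ∸ (suc p + i)     ≡⟨ [m+n]∸[m+o]≡n∸o (suc p) (suc d) i ⟩
    suc d ∸ i                       ≡⟨ +-∸-assoc 1 i≤d ⟩
    suc (d ∸ i)                     ∎

tailSum≡sumFromTo : ∀ p n → tailSum (suc p) n ≡ sumFromTo (suc p) n (tailTerm (suc p) n)
tailSum≡sumFromTo p n with n ≤? p
... | yes n≤p =
  trans (tailSum-vanishes (suc p) n (s≤s n≤p))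
        (sym (trans (sum-map-applyUpTo _ _ (n ∸ p))
                    (cong (λ L → sumBelow L (tailTerm (suc p) n ∘ (suc p +_))) (m≤n⇒m∸n≡0 n≤p))))
... | no n≰p with m≤n⇒∃[o]m+o≡n (≰⇒> n≰p)
...   | d , refl = begin
  binomConv fibProduct (suc (2 * p)) (suc p + d + p)
    ≡⟨ cong (binomConv fibProduct (suc (2 * p))) (arith p d) ⟩
  binomConv fibProduct (suc (2 * p)) (suc (2 * p) + d)
    ≡⟨ binomConv-from fibProduct (suc (2 * p)) d ⟩
  sumBelow (suc d) (λ i → ((suc (2 * p) + i) C suc (2 * p)) * fibProduct (d ∸ i))
    ≡⟨ sumBelow-cong (suc d) (λ i i<1+d → sym (tailTerm-shifted p d i (≤-pred i<1+d))) ⟩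
  sumBelow (suc d) (λ i → tailTerm (suc p) (suc p + d) (suc p + i))
    ≡⟨ cong (λ L → sumBelow L (λ i → tailTerm (suc p) (suc p + d) (suc p + i))) count-terms ⟩
  sumBelow (suc (p + d) ∸ p) (λ i → tailTerm (suc p) (suc p + d) (suc p + i))
    ≡⟨ sym (sum-map-applyUpTo (tailTerm (suc p) (suc p + d)) (suc p +_) (suc (p + d) ∸ p)) ⟩
  sumFromTo (suc p) (suc p + d) (tailTerm (suc p) (suc p + d)) ∎
  where
  arith : ∀ p d → suc p + d + p ≡ suc (2 * p) + d
  arith = solve-∀
  count-terms : suc d ≡ suc (p + d) ∸ p
  count-terms = trans (sym (m+n∸m≡n p (suc d))) (cong (_∸ p) (+-suc p d))

mainTheorem16 : (p n : ℕ) → 0 < p →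
    f n * f (suc n) ≡
      sumFromTo 0 (p ∸ 1) (λ r → Ctil r n)
      + sumFromTo p n (λ j → ((j + p ∸ 1) C (2 * p ∸ 1)) * f (n ∸ j) * f (suc n ∸ j))
mainTheorem16 (suc p) n _ =
  trans (fibProduct-telescope (suc p) n) (cong₂ _+_ (sym tilingSum) (tailSum≡sumFromTo p n))
  where
  tilingSum : sumFromTo 0 p (λ r → Ctil r n) ≡ sumBelow (suc p) (λ r → oddTilings r n)
  tilingSum = trans (sum-map-applyUpTo _ id (suc p)) (sumBelow-cong (suc p) (λ r _ → Ctil≡oddTilings r n))
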